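{- Let $\mathbb{C}$ be a complex and $S,T\in\mathbb{C}$. If $\max(S)=\max(T)$, then $S=T$.
   Context: Fix a finite set $\mathsf{Ag}$ of agents and let $\mathsf{Ag}_{si}=\{(A,i)\mid A\subseteq\mathsf{Ag},\ i\in\mathbb{N}\}$. For $S\subseteq\mathsf{Ag}_{si}$, $(A,i)\in S$ is maximal in $S$ if $|A|\ge|B|$ for all $(B,j)\in S$. A nonempty $S\subseteq\mathsf{Ag}_{si}$ is a simplex if (S1) it has a unique maximal element, denoted $\max(S)$; (S2) for every $(B,i)\in S$ and $C\subseteq B$ there is exactly one $j\in\mathbb{N}$ with $(C,j)\in S$; (S3) if $(B,i)\in S$ and $(A,j)=\max(S)$ then $B\subseteq A$. A set $\mathbb{C}$ of simplices is a complex if for all $S,T\in\mathbb{C}$: whenever $(A,i)\in S$ and $(A,i)\in T$, then for all $B\subseteq A$ and all $j$, $(B,j)\in S$ iff $(B,j)\in T$. -}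

module Defs where

open import Level using (0ℓ)
open import Data.Nat using (ℕ; _≤_)
open import Data.Fin.Subset using (Subset; ∣_∣; _⊆_)
open import Data.Product using (Σ; _×_; _,_; ∃)
open import Relation.Binary.PropositionalEquality using (_≡_)

-- Agents: Fin n (a finite set of n agents). Agent subsets: Subset n.
-- Ag_si = pairs (A , i) with A ⊆ Ag and i ∈ ℕ.
Agsi : ℕ → Set
Agsi n = Subset n × ℕ

SetSi : ℕ → Set₁
SetSi n = Agsi n → Set

IsMaximal : ∀ {n} → SetSi n → Agsi n → Set
IsMaximal S (A , i) = S (A , i) × (∀ B j → S (B , j) → ∣ B ∣ ≤ ∣ A ∣)

IsMax : ∀ {n} → SetSi n → Agsi n → Set
IsMax S a = IsMaximal S a × (∀ b → IsMaximal S b → b ≡ a)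

record IsSimplex {n : ℕ} (S : SetSi n) : Set where
  field
    nonempty : ∃ λ a → S a
    S1 : ∃ λ a → IsMax S a
    S2 : ∀ B i → S (B , i) → ∀ C → C ⊆ B →
         Σ ℕ λ j → S (C , j) × (∀ k → S (C , k) → k ≡ j)
    S3 : ∀ B i A j → S (B , i) → IsMax S (A , j) → B ⊆ A

SetOfSimplices : ℕ → Set₂
SetOfSimplices n = SetSi n → Set₁

record IsComplex {n : ℕ} (ℂ : SetOfSimplices n) : Set₁ where
  field
    simplices : ∀ S → ℂ S → IsSimplex S
    coherent : ∀ S T → ℂ S → ℂ T → ∀ A i → S (A , i) → T (A , i) →
               ∀ B → B ⊆ A → ∀ j → (S (B , j) → T (B , j)) × (T (B , j) → S (B , j))

_≐_ : ∀ {n} → SetSi n → SetSi n → Set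
S ≐ T = ∀ x → (S x → T x) × (T x → S x)

{-# OPTIONS --safe #-}
module Submission where

open import Defs
open import Data.Nat using (ℕ)
open import Data.Product using (_,_; proj₁)
open import Relation.Unary using (_⊆_)

max∈ : ∀ {n} {S : SetSi n} {m : Agsi n} → IsMax S m → S m
max∈ ((m∈S , _) , _) = m∈S

module _ {n : ℕ} {ℂ : SetOfSimplices n} (ℂ-complex : IsComplex ℂ) where
  open IsComplex ℂ-complex

  shared-max⇒⊆ : ∀ {S T : SetSi n} → ℂ S → ℂ T →
                 ∀ {m : Agsi n} → IsMax S m → IsMax T m → S ⊆ T
  shared-max⇒⊆ {S} ℂS ℂT {A , i} maxS maxT {B , j} B∈S =
    proj₁ (coherent _ _ ℂS ℂT A i (max∈ maxS) (max∈ maxT) B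
                    (IsSimplex.S3 (simplices S ℂS) B j A i B∈S maxS) j) B∈S

lemma2p3 : ∀ {n : ℕ} (ℂ : SetOfSimplices n) → IsComplex ℂ →
           ∀ (S T : SetSi n) → ℂ S → ℂ T →
           ∀ (m : Agsi n) → IsMax S m → IsMax T m → S ≐ T
lemma2p3 ℂ ℂ-complex S T ℂS ℂT m maxS maxT x =
    shared-max⇒⊆ ℂ-complex ℂS ℂT maxS maxT
  , shared-max⇒⊆ ℂ-complex ℂT ℂS maxT maxS
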